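{- Let $P$ be a finite set of propositions, $\Pi=2^P$, $\phi$ a formula of the LTL fragment described in the context, $\pi\in\Pi^*$ a finite trace and $i\in\mathbb{N}_{>0}$. Then $\mu_\pi(\phi,i)=\top \iff e_\pi(\phi,i)=\top$, $\mu_\pi(\phi,i)=\bot \iff e_\pi(\phi,i)=\bot$, $\mu_\pi(\phi,i)=\,? \iff e_\pi(\phi,i)\in\{\top_P,\bot_P,?\}$.
   Context: Traces $\pi=\pi_1\dots\pi_{|\pi|}$ over $\Pi$. Formulas: $\phi ::= p \mid \neg\phi \mid \phi_1\vee\phi_2 \mid \mathbf{X}\phi \mid \phi_1\,\mathbf{U}\,\phi_2 \mid \mathbf{F}\phi$, $p\in P$. Three-valued semantics $\mu_\pi(\phi,i)\in\{\bot,?,\top\}$ ($\bot<?<\top$, $\neg_3$ swaps $\top,\bot$ and fixes $?$, $\vee_3=\max$, $\wedge_3=\min$): $\mu_\pi(p,i)=\top$ if $i\le|\pi|,p\in\pi_i$; $\bot$ if $i\le|\pi|,p\notin\pi_i$; $?$ if $i>|\pi|$; $\mu_\pi(\neg\phi,i)=\neg_3\mu_\pi(\phi,i)$; $\mu_\pi(\phi_1\vee\phi_2,i)=\mu_\pi(\phi_1,i)\vee_3\mu_\pi(\phi_2,i)$; $\mu_\pi(\mathbf{X}\phi,i)=\mu_\pi(\phi,i+1)$; $\mu_\pi(\mathbf{F}\phi,i)=\mu_\pi(\phi,i)\vee_3\mu_\pi(\mathbf{X}\mathbf{F}\phi,i)$ if $i\le|\pi|$, else $\mu_\pi(\phi,i)$;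 $\mu_\pi(\phi_1\mathbf{U}\phi_2,i)=\mu_\pi(\phi_2,i)\vee_3(\mu_\pi(\phi_1,i)\wedge_3\mu_\pi(\mathbf{X}(\phi_1\mathbf{U}\phi_2),i))$ if $i\le|\pi|$, else $\mu_\pi(\phi_2,i)$. Counting semantics: $\mathbb{N}_+=\mathbb{N}_0\cup\{\infty,-\}$ ordered $n<\infty<-$; $a\oplus b=a+b$ if $a,b\in\mathbb{N}_0$, else $\max\{a,b\}$; $\mathrm{swap}(s,f)=(f,s)$; $(s,f)\oplus1=(s\oplus1,f\oplus1)$; $(s,f)\sqcup(s',f')=(\min(s,s'),\max(f,f'))$; $(s,f)\sqcap(s',f')=(\max(s,s'),\min(f,f'))$. $d_\pi(p,i)=(0,-)$ if $i\le|\pi|,p\in\pi_i$; $(-,0)$ if $i\le|\pi|,p\notin\pi_i$; $(0,0)$ if $i>|\pi|$; $d_\pi(\neg\phi,i)=\mathrm{swap}\,d_\pi(\phi,i)$; $d_\pi(\phi_1\vee\phi_2,i)=d_\pi(\phi_1,i)\sqcup d_\pi(\phi_2,i)$; $d_\pi(\mathbf{X}\phi,i)=d_\pi(\phi,i+1)\oplus1$; $d_\pi(\phi\mathbf{U}\psi,i)=d_\pi(\psi,i)\sqcup(d_\pi(\phi,i)\sqcap d_\pi(\mathbf{X}(\phi\mathbf{U}\psi),i))$ if $i\le|\pi|$, else $d_\pi(\psi,i)\sqcup(d_\pi(\phi,i)\sqcap(-,\infty))$; $d_\pi(\mathbf{F}\phi,i)=d_\pi(\phi,i)\sqcup d_\pi(\mathbf{X}\mathbf{F}\phi,i)$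 if $i\le|\pi|$, else $d_\pi(\phi,i)\sqcup(-,\infty)$. Write $d_\pi(\phi,i)=(s_\pi(\phi,i),f_\pi(\phi,i))$. Five-valued domain $\bot<\bot_P<?<\top_P<\top$ with $\neg$ exchanging $\top\leftrightarrow\bot$, $\top_P\leftrightarrow\bot_P$, fixing $?$; $x\vee y=\max$, $x\wedge y=\neg(\neg x\vee\neg y)$. Prediction predicate $\mathrm{pred}_\pi(\phi,i)\in\{\bot,?,\top\}$ (ordered $\bot<?<\top$): $=\top$ if there is $j<i$ with $d_\pi(\phi,j)=(s',-)$ and $s_\pi(\phi,i)\le s'$; $=\,?$ if there is no $j<i$ with $d_\pi(\phi,j)$ of the form $(s',-)$; $=\bot$ if such $j<i$ exists and $s_\pi(\phi,i)>\max\{s' \mid j<i,\ d_\pi(\phi,j)=(s',-)\}$. Predictive evaluation $e_\pi(\phi,i)$, where $a,b_1,b_2\in\mathbb{N}_0$, $a\le|\pi|-i$, $b_j>|\pi|-i$: if $d_\pi(\phi,i)=(a,-)$ then $\top$; if $d_\pi(\phi,i)=(b_1,b_2)$ then $\top_P$ if $\mathrm{pred}_\pi(\phi,i)>\mathrm{pred}_\pi(\neg\phi,i)$, $r_\pi(\phi,i)$ if they are equal, $\bot_P$ if $\mathrm{pred}_\pi(\phi,i)<\mathrm{pred}_\pi(\neg\phi,i)$; if $d_\pi(\phi,i)=(b_1,\infty)$ then $\top_P$, $r_\pi(\phi,i)$, $\bot_P$ according as $\mathrm{pred}_\pi(\phi,i)$ is $\top$, $?$, $\bot$; if $d_\pi(\phi,i)=(\infty,b_1)$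 then $\neg e_\pi(\neg\phi,i)$; if $d_\pi(\phi,i)=(\infty,\infty)$ then $r_\pi(\phi,i)$; if $d_\pi(\phi,i)=(-,a)$ then $\bot$. Auxiliary $r_\pi$: $r_\pi(p,i)=\,?$; $r_\pi(\neg\phi,i)=\neg e_\pi(\phi,i)$; $r_\pi(\phi_1\vee\phi_2,i)=e_\pi(\phi_1,i)\vee e_\pi(\phi_2,i)$; $r_\pi(\mathbf{X}^n\phi,i)=e_\pi(\phi,i+n)$ ($n\ge1$ the number of leading $\mathbf{X}$ operators); $r_\pi(\mathbf{F}\phi,i)=e_\pi(\phi,i)\vee r_\pi(\mathbf{X}\mathbf{F}\phi,i)$ if $i\le|\pi|$, else $e_\pi(\phi,i)$; $r_\pi(\phi_1\mathbf{U}\phi_2,i)=e_\pi(\phi_2,i)\vee(e_\pi(\phi_1,i)\wedge e_\pi(\mathbf{X}(\phi_1\mathbf{U}\phi_2),i))$ if $i\le|\pi|$, else $e_\pi(\phi_2,i)$. -}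

module Defs where

open import Data.Nat using (ℕ; zero; suc; _+_; _∸_; _≤ᵇ_; _<ᵇ_)
open import Data.Bool using (Bool; true; false; if_then_else_; _∧_; _∨_; not)
open import Data.Fin using (Fin)
open import Data.Fin.Subset using (Subset)
open import Data.Vec using (lookup)
open import Data.List using (List; []; _∷_; length)
open import Data.Maybe using (Maybe; just; nothing)
open import Data.Product using (_×_; _,_; proj₁; proj₂)

data Formula (n : ℕ) : Set where
  atom : Fin n → Formula n
  ¬ᶠ_  : Formula n → Formula n
  _∨ᶠ_ : Formula n → Formula n → Formula n
  𝐗    : Formula n → Formula n
  _𝐔_  : Formula n → Formula n → Formula n
  𝐅    : Formula n → Formula n

-- A letter of Π = 2^P is a subset of P; a trace is a finite list of letters.
Letter : ℕ → Set
Letter n = Subset n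

Trace : ℕ → Set
Trace n = List (Letter n)

nth : ∀ {A : Set} → List A → ℕ → Maybe A
nth []       _       = nothing
nth (x ∷ xs) zero    = just x
nth (x ∷ xs) (suc k) = nth xs k

-- Generic unfolding "value at j from value at j+1" with fuel:
-- iter base step k j = step j (step (j+1) (... base (j+k))).
iter : ∀ {A : Set} → (ℕ → A) → (ℕ → A → A) → ℕ → ℕ → A
iter base step zero    j = base j
iter base step (suc k) j = step j (iter base step k (suc j))

data V3 : Set where
  ⊥₃ ?₃ ⊤₃ : V3

rank3 : V3 → ℕ
rank3 ⊥₃ = 0
rank3 ?₃ = 1
rank3 ⊤₃ = 2

¬₃ : V3 → V3
¬₃ ⊥₃ = ⊤₃
¬₃ ?₃ = ?₃
¬₃ ⊤₃ = ⊥₃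

_∨₃_ : V3 → V3 → V3
x ∨₃ y = if rank3 x ≤ᵇ rank3 y then y else x

_∧₃_ : V3 → V3 → V3
x ∧₃ y = if rank3 x ≤ᵇ rank3 y then x else y

data V5 : Set where
  ⊥₅ ⊥P ?₅ ⊤P ⊤₅ : V5

rank5 : V5 → ℕ
rank5 ⊥₅ = 0
rank5 ⊥P = 1
rank5 ?₅ = 2
rank5 ⊤P = 3
rank5 ⊤₅ = 4

¬₅ : V5 → V5
¬₅ ⊥₅ = ⊤₅
¬₅ ⊥P = ⊤P
¬₅ ?₅ = ?₅
¬₅ ⊤P = ⊥P
¬₅ ⊤₅ = ⊥₅

_∨₅_ : V5 → V5 → V5
x ∨₅ y = if rank5 x ≤ᵇ rank5 y then y else x

_∧₅_ : V5 → V5 → V5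
x ∧₅ y = ¬₅ (¬₅ x ∨₅ ¬₅ y)

data ℕ₊ : Set where
  fin  : ℕ → ℕ₊
  ∞    : ℕ₊
  dash : ℕ₊

_≤₊ᵇ_ : ℕ₊ → ℕ₊ → Bool
fin a ≤₊ᵇ fin b = a ≤ᵇ b
fin a ≤₊ᵇ ∞     = true
fin a ≤₊ᵇ dash  = true
∞     ≤₊ᵇ fin b = false
∞     ≤₊ᵇ ∞     = true
∞     ≤₊ᵇ dash  = true
dash  ≤₊ᵇ fin b = false
dash  ≤₊ᵇ ∞     = false
dash  ≤₊ᵇ dash  = true

max₊ : ℕ₊ → ℕ₊ → ℕ₊
max₊ a b = if a ≤₊ᵇ b then b else a

min₊ : ℕ₊ → ℕ₊ → ℕ₊
min₊ a b = if a ≤₊ᵇ b then a else b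

_⊕_ : ℕ₊ → ℕ₊ → ℕ₊
fin a ⊕ fin b = fin (a + b)
a     ⊕ b     = max₊ a b

Cnt : Set
Cnt = ℕ₊ × ℕ₊

swap : Cnt → Cnt
swap (s , f) = (f , s)

_⊕1 : Cnt → Cnt
(s , f) ⊕1 = (s ⊕ fin 1 , f ⊕ fin 1)

_⊔_ : Cnt → Cnt → Cnt
(s , f) ⊔ (s' , f') = (min₊ s s' , max₊ f f')

_⊓_ : Cnt → Cnt → Cnt
(s , f) ⊓ (s' , f') = (max₊ s s' , min₊ f f')

-- Positions are 1-based: π_i is the
-- element of π at 0-based index i ∸ 1, defined for 1 ≤ i ≤ |π|.
-- "i ≤ |π|" case splits are implemented by the fuel suc |π| ∸ i,
-- which is ≥ 1 exactly when i ≤ |π| (and decreases as i increases).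

module Semantics {n : ℕ} (π : Trace n) where

  len : ℕ
  len = length π

  fuel : ℕ → ℕ
  fuel i = suc len ∸ i

  holds : Fin n → ℕ → Maybe Bool
  holds p i with nth π (i ∸ 1)
  ... | just σ  = just (lookup σ p)
  ... | nothing = nothing

  μ : Formula n → ℕ → V3
  μ (atom p) i with holds p i
  ... | just true  = ⊤₃
  ... | just false = ⊥₃
  ... | nothing    = ?₃
  μ (¬ᶠ φ) i = ¬₃ (μ φ i)
  μ (φ ∨ᶠ ψ) i = μ φ i ∨₃ μ ψ i
  μ (𝐗 φ) i = μ φ (suc i)
  -- v = μ(X(φ U ψ), j) = μ(φ U ψ, j+1)
  μ (φ 𝐔 ψ) i = iter (λ j → μ ψ j) (λ j v → μ ψ j ∨₃ (μ φ j ∧₃ v)) (fuel i) i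
  -- v = μ(X F φ, j) = μ(F φ, j+1)
  μ (𝐅 φ) i = iter (λ j → μ φ j) (λ j v → μ φ j ∨₃ v) (fuel i) i

  d : Formula n → ℕ → Cnt
  d (atom p) i with holds p i
  ... | just true  = (fin 0 , dash)
  ... | just false = (dash , fin 0)
  ... | nothing    = (fin 0 , fin 0)
  d (¬ᶠ φ) i = swap (d φ i)
  d (φ ∨ᶠ ψ) i = d φ i ⊔ d ψ i
  d (𝐗 φ) i = d φ (suc i) ⊕1
  -- v = d(φ U ψ, j+1), so v ⊕1 = d(X(φ U ψ), j)
  d (φ 𝐔 ψ) i = iter (λ j → d ψ j ⊔ (d φ j ⊓ (dash , ∞)))
                     (λ j v → d ψ j ⊔ (d φ j ⊓ (v ⊕1))) (fuel i) i
  d (𝐅 φ) i = iter (λ j → d φ j ⊔ (dash , ∞)) (λ j v → d φ j ⊔ (v ⊕1)) (fuel i) i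

  s : Formula n → ℕ → ℕ₊
  s φ i = proj₁ (d φ i)

  isDash : ℕ₊ → Bool
  isDash dash = true
  isDash _    = false

  before : ℕ → List ℕ
  before i = go (i ∸ 1)
    where
    go : ℕ → List ℕ
    go zero    = []
    go (suc k) = go k Data.List.++ (suc k ∷ [])

  anyL : (ℕ → Bool) → List ℕ → Bool
  anyL P []       = false
  anyL P (x ∷ xs) = P x ∨ anyL P xs

  pred : Formula n → ℕ → V3
  pred φ i =
    if anyL (λ j → isDash (proj₂ (d φ j)) ∧ (s φ i ≤₊ᵇ s φ j)) (before i) then ⊤₃
    else if anyL (λ j → isDash (proj₂ (d φ j))) (before i) then ⊥₃
    else ?₃

  -- the case analysis of e_π(φ,i) on d_π(φ,i), given the value rv = r_π(φ,i)
  eAt : Formula n → ℕ → V5 → V5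
  eAt φ i rv = go (d φ i)
    where
    small : ℕ → Bool
    small a = a + i ≤ᵇ len
    big : ℕ → Bool
    big b = len <ᵇ b + i
    cmp : V3 → V3 → V5
    cmp x y = if rank3 y <ᵇ rank3 x then ⊤P
              else if rank3 x <ᵇ rank3 y then ⊥P else rv
    go : Cnt → V5
    go (fin a , dash)   = if small a then ⊤₅ else ?₅
    go (dash , fin a)   = if small a then ⊥₅ else ?₅
    go (fin b₁ , fin b₂) =
      if big b₁ ∧ big b₂ then cmp (pred φ i) (pred (¬ᶠ φ) i) else ?₅
    go (fin b₁ , ∞)     = if big b₁ then cmp (pred φ i) ?₃ else ?₅
    -- d(φ,i) = (∞,b₁): e(φ,i) = ¬ e(¬φ,i), where d(¬φ,i) = (b₁,∞);
    -- the "?" subcase is read as r(φ,i)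
    go (∞ , fin b₁)     = if big b₁ then cmp ?₃ (pred (¬ᶠ φ) i) else ?₅
    go (∞ , ∞)          = rv
    go _                = ?₅

  mutual
    e : Formula n → ℕ → V5
    e φ i = eAt φ i (r φ i)

    r : Formula n → ℕ → V5
    r (atom p) i = ?₅
    r (¬ᶠ φ) i = ¬₅ (e φ i)
    r (φ ∨ᶠ ψ) i = e φ i ∨₅ e ψ i
    r (𝐗 φ) i = rX φ (suc i)
    -- v = r(X F φ, j) = e(F φ, j+1) = eAt (F φ) (j+1) (r (F φ) (j+1))
    r (𝐅 φ) i = iter (λ j → e φ j) (λ j v → e φ j ∨₅ eAt (𝐅 φ) (suc j) v) (fuel i) i
    -- v = r(φ U ψ, j+1); e(X(φ U ψ), j) = eAt (X(φ U ψ)) j (e(φ U ψ, j+1))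
    r (φ 𝐔 ψ) i = iter (λ j → e ψ j)
                       (λ j v → e ψ j ∨₅ (e φ j ∧₅ eAt (𝐗 (φ 𝐔 ψ)) j (eAt (φ 𝐔 ψ) (suc j) v)))
                       (fuel i) i

    -- r(X^n φ, i) = e(φ, i+n), n = number of leading X's: rX strips them
    rX : Formula n → ℕ → V5
    rX (𝐗 φ) i = rX φ (suc i)
    rX (atom p) i = e (atom p) i
    rX (¬ᶠ φ) i = e (¬ᶠ φ) i
    rX (φ ∨ᶠ ψ) i = e (φ ∨ᶠ ψ) i
    rX (φ 𝐔 ψ) i = e (φ 𝐔 ψ) i
    rX (𝐅 φ) i = e (𝐅 φ) i

-- The counting semantics refines the three-valued one: d(φ,i) has a dash component exactly
-- when μ(φ,i) is settled, and the other component is then a distance a with a + i ≤ |π|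
-- (the invariant Verdict, proved by induction on φ, and for U and F by backward induction
-- from the end of the trace). So e(φ,i) returns ⊤ or ⊥ exactly on settled verdicts, and
-- otherwise a predictive value or r(φ,i); r mirrors the recursive definition of μ with e in
-- place of μ, hence is itself unsettled whenever μ(φ,i) = ?.
module Submission where

open import Defs
open import Data.Nat using (ℕ; _>_)
open import Data.Product using (_×_)
open import Data.Sum using (_⊎_)
open import Relation.Binary.PropositionalEquality using (_≡_)
open import Function.Bundles using (_⇔_)

open import Data.Bool using (true; false; if_then_else_; _∧_)
open import Data.Bool.Properties using (T-≡)
open import Data.Empty using (⊥-elim)
open import Data.List using (List; _∷_; length)
open import Data.Maybe using (just; nothing)
open import Data.Nat using (zero; suc; _+_; _∸_; _≤_; _<_; _≤ᵇ_; _<ᵇ_; _≤?_; z≤n; s≤s)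
open import Data.Nat.Properties
  using (+-suc; +-assoc; +-∸-assoc; m≤n⇒m∸n≡0; m≤m+n; ≰⇒>; <⇒≤; ≤-trans; +-monoˡ-≤; <⇒≱; m+n≤o⇒n≤o; ≤⇒≤ᵇ; ≤ᵇ-reflects-≤)
open import Data.Product using (_,_)
open import Data.Sum using (inj₁; inj₂)
open import Function.Bundles using (mk⇔; Equivalence)
open import Relation.Binary.PropositionalEquality using (refl; sym; trans; cong; cong₂; subst; module ≡-Reasoning)
open import Relation.Nullary using (¬_; yes; no)
open import Relation.Nullary.Reflects using (ofʸ; ofⁿ)

collapse : V5 → V3
collapse ⊤₅ = ⊤₃
collapse ⊥₅ = ⊥₃
collapse _  = ?₃

collapse-¬ : ∀ a → collapse (¬₅ a) ≡ ¬₃ (collapse a)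
collapse-¬ ⊥₅ = refl
collapse-¬ ⊥P = refl
collapse-¬ ?₅ = refl
collapse-¬ ⊤P = refl
collapse-¬ ⊤₅ = refl

collapse-∨ : ∀ a b → collapse (a ∨₅ b) ≡ collapse a ∨₃ collapse b
collapse-∨ ⊥₅ = λ { ⊥₅ → refl ; ⊥P → refl ; ?₅ → refl ; ⊤P → refl ; ⊤₅ → refl }
collapse-∨ ⊥P = λ { ⊥₅ → refl ; ⊥P → refl ; ?₅ → refl ; ⊤P → refl ; ⊤₅ → refl }
collapse-∨ ?₅ = λ { ⊥₅ → refl ; ⊥P → refl ; ?₅ → refl ; ⊤P → refl ; ⊤₅ → refl }
collapse-∨ ⊤P = λ { ⊥₅ → refl ; ⊥P → refl ; ?₅ → refl ; ⊤P → refl ; ⊤₅ → refl }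
collapse-∨ ⊤₅ = λ { ⊥₅ → refl ; ⊥P → refl ; ?₅ → refl ; ⊤P → refl ; ⊤₅ → refl }

¬₃-∨₃-dual : ∀ x y → ¬₃ (¬₃ x ∨₃ ¬₃ y) ≡ x ∧₃ y
¬₃-∨₃-dual ⊥₃ = λ { ⊥₃ → refl ; ?₃ → refl ; ⊤₃ → refl }
¬₃-∨₃-dual ?₃ = λ { ⊥₃ → refl ; ?₃ → refl ; ⊤₃ → refl }
¬₃-∨₃-dual ⊤₃ = λ { ⊥₃ → refl ; ?₃ → refl ; ⊤₃ → refl }

collapse-∧ : ∀ a b → collapse (a ∧₅ b) ≡ collapse a ∧₃ collapse b
collapse-∧ a b = begin
  collapse (¬₅ (¬₅ a ∨₅ ¬₅ b))             ≡⟨ collapse-¬ (¬₅ a ∨₅ ¬₅ b) ⟩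
  ¬₃ (collapse (¬₅ a ∨₅ ¬₅ b))             ≡⟨ cong ¬₃ (collapse-∨ (¬₅ a) (¬₅ b)) ⟩
  ¬₃ (collapse (¬₅ a) ∨₃ collapse (¬₅ b))  ≡⟨ cong ¬₃ (cong₂ _∨₃_ (collapse-¬ a) (collapse-¬ b)) ⟩
  ¬₃ (¬₃ (collapse a) ∨₃ ¬₃ (collapse b))  ≡⟨ ¬₃-∨₃-dual (collapse a) (collapse b) ⟩
  collapse a ∧₃ collapse b                 ∎
  where open ≡-Reasoning

collapse-if : ∀ b {x y} → collapse x ≡ ?₃ → collapse y ≡ ?₃ → collapse (if b then x else y) ≡ ?₃
collapse-if true  x? _ = x?
collapse-if false _ y? = y?

collapse-ranked : ∀ {rv} → collapse rv ≡ ?₃ → ∀ x y →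
  collapse (if rank3 y <ᵇ rank3 x then ⊤P else if rank3 x <ᵇ rank3 y then ⊥P else rv) ≡ ?₃
collapse-ranked rv? x y = collapse-if (rank3 y <ᵇ rank3 x) refl (collapse-if (rank3 x <ᵇ rank3 y) refl rv?)

collapse-agrees : ∀ {x} a → collapse a ≡ x →
    ((x ≡ ⊤₃) ⇔ (a ≡ ⊤₅))
    × ((x ≡ ⊥₃) ⇔ (a ≡ ⊥₅))
    × ((x ≡ ?₃) ⇔ ((a ≡ ⊤P) ⊎ (a ≡ ⊥P) ⊎ (a ≡ ?₅)))
collapse-agrees ⊥₅ refl =
  mk⇔ (λ ()) (λ ()) , mk⇔ (λ _ → refl) (λ _ → refl) , mk⇔ (λ ()) λ { (inj₁ ()) ; (inj₂ (inj₁ ())) ; (inj₂ (inj₂ ())) }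
collapse-agrees ⊥P refl =
  mk⇔ (λ ()) (λ ()) , mk⇔ (λ ()) (λ ()) , mk⇔ (λ _ → inj₂ (inj₁ refl)) (λ _ → refl)
collapse-agrees ?₅ refl =
  mk⇔ (λ ()) (λ ()) , mk⇔ (λ ()) (λ ()) , mk⇔ (λ _ → inj₂ (inj₂ refl)) (λ _ → refl)
collapse-agrees ⊤P refl =
  mk⇔ (λ ()) (λ ()) , mk⇔ (λ ()) (λ ()) , mk⇔ (λ _ → inj₁ refl) (λ _ → refl)
collapse-agrees ⊤₅ refl =
  mk⇔ (λ _ → refl) (λ _ → refl) , mk⇔ (λ ()) (λ ()) , mk⇔ (λ ()) λ { (inj₁ ()) ; (inj₂ (inj₁ ())) ; (inj₂ (inj₂ ())) }

backward-ind : ∀ (L : ℕ) (P : ℕ → Set) → (∀ j → L < j → P j) → (∀ j → j ≤ L → P (suc j) → P j) → ∀ j → P j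
backward-ind L P beyond inside j = go (suc L) j (m≤m+n (suc L) j)
  where
  go : ∀ k j → L < k + j → P j
  go 0       j L<j   = beyond j L<j
  go (suc k) j L<k+j with j ≤? L
  ... | yes j≤L = inside j j≤L (go k (suc j) (subst (L <_) (sym (+-suc k j)) L<k+j))
  ... | no  j≰L = beyond j (≰⇒> j≰L)

module _ {A : Set} {b : ℕ → A} {s : ℕ → A → A} {L j : ℕ} where

  iter-inside : j ≤ L → iter b s (suc L ∸ j) j ≡ s j (iter b s (suc L ∸ suc j) (suc j))
  iter-inside j≤L rewrite +-∸-assoc 1 j≤L = refl

  iter-beyond : L < j → iter b s (suc L ∸ j) j ≡ b j
  iter-beyond L<j rewrite m≤n⇒m∸n≡0 L<j = refl

data Bounded : ℕ₊ → Set where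
  fin : ∀ a → Bounded (fin a)
  ∞   : Bounded ∞

Bounded-min : ∀ {x y} → Bounded x → Bounded y → Bounded (min₊ x y)
Bounded-min (fin a) (fin b) with a ≤ᵇ b
... | true  = fin a
... | false = fin b
Bounded-min (fin a) ∞ = fin a
Bounded-min ∞ (fin b) = fin b
Bounded-min ∞ ∞ = ∞

Bounded-max : ∀ {x y} → Bounded x → Bounded y → Bounded (max₊ x y)
Bounded-max (fin a) (fin b) with a ≤ᵇ b
... | true  = fin b
... | false = fin a
Bounded-max (fin a) ∞ = ∞
Bounded-max ∞ (fin b) = ∞
Bounded-max ∞ ∞ = ∞

Bounded-⊕1 : ∀ {x} → Bounded x → Bounded (x ⊕ fin 1)
Bounded-⊕1 (fin a) = fin (a + 1)
Bounded-⊕1 ∞       = ∞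

min₊-dashʳ : ∀ x → min₊ x dash ≡ x
min₊-dashʳ (fin a) = refl
min₊-dashʳ ∞       = refl
min₊-dashʳ dash    = refl

max₊-dashʳ : ∀ x → max₊ x dash ≡ dash
max₊-dashʳ (fin a) = refl
max₊-dashʳ ∞       = refl
max₊-dashʳ dash    = refl

module Verdicts (len : ℕ) where

  -- The paper's condition a ≤ |π| − j, without truncated subtraction.
  data Within (j : ℕ) : ℕ₊ → Set where
    fin : ∀ {a} → a + j ≤ len → Within j (fin a)

  Within⇒Bounded : ∀ {j x} → Within j x → Bounded x
  Within⇒Bounded (fin {a} _) = fin a

  Within-beyond : ∀ {j x} → len < j → ¬ Within j x
  Within-beyond len<j (fin {a} a+j≤len) = <⇒≱ len<j (m+n≤o⇒n≤o a a+j≤len)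

  Within-minˡ : ∀ {j x} y → Within j x → Within j (min₊ x y)
  Within-minˡ (fin b) (fin {a} w) with a ≤ᵇ b | ≤ᵇ-reflects-≤ a b
  ... | true  | _       = fin w
  ... | false | ofⁿ a≰b = fin (≤-trans (+-monoˡ-≤ _ (<⇒≤ (≰⇒> a≰b))) w)
  Within-minˡ ∞    (fin w) = fin w
  Within-minˡ dash (fin w) = fin w

  Within-minʳ : ∀ {j y} x → Within j y → Within j (min₊ x y)
  Within-minʳ (fin a) (fin {b} w) with a ≤ᵇ b | ≤ᵇ-reflects-≤ a b
  ... | true  | ofʸ a≤b = fin (≤-trans (+-monoˡ-≤ _ a≤b) w)
  ... | false | _       = fin w
  Within-minʳ ∞    (fin w) = fin w
  Within-minʳ dash (fin w) = fin w

  Within-max : ∀ {j x y} → Within j x → Within j y → Within j (max₊ x y)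
  Within-max (fin {a} w) (fin {b} w') with a ≤ᵇ b
  ... | true  = fin w'
  ... | false = fin w

  Within-⊕1 : ∀ {j x} → Within (suc j) x → Within j (x ⊕ fin 1)
  Within-⊕1 {j} (fin {a} w) = fin (subst (_≤ len) (sym (+-assoc a 1 j)) w)

  data Verdict (j : ℕ) : Cnt → V3 → Set where
    sat       : ∀ {s} → Within j s → Verdict j (s , dash) ⊤₃
    unsat     : ∀ {f} → Within j f → Verdict j (dash , f) ⊥₃
    undecided : ∀ {s f} → Bounded s → Bounded f → Verdict j (s , f) ?₃

  module _ {j : ℕ} where

    Verdict-swap : ∀ {c v} → Verdict j c v → Verdict j (swap c) (¬₃ v)
    Verdict-swap (sat w)           = unsat w
    Verdict-swap (unsat w)         = sat w
    Verdict-swap (undecided bs bf) = undecided bf bs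

    -- Components are matched to constructors only where min₊/max₊ against dash must compute.
    Verdict-⊔ : ∀ {c c' v v'} → Verdict j c v → Verdict j c' v' → Verdict j (c ⊔ c') (v ∨₃ v')
    Verdict-⊔ (sat w)                   (sat w')                = sat (Within-minˡ _ w)
    Verdict-⊔ (sat w)                   (unsat (fin _))         = sat (Within-minˡ _ w)
    Verdict-⊔ (sat w)                   (undecided _ (fin _))   = sat (Within-minˡ _ w)
    Verdict-⊔ (sat w)                   (undecided _ ∞)         = sat (Within-minˡ _ w)
    Verdict-⊔ (unsat (fin _))           (sat w'@(fin _))        = sat w'
    Verdict-⊔ (unsat w)                 (unsat w')              = unsat (Within-max w w')
    Verdict-⊔ (unsat w@(fin _))         (undecided bs@(fin _) bf) = undecided bs (Bounded-max (Within⇒Bounded w) bf)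
    Verdict-⊔ (unsat w@(fin _))         (undecided ∞ bf)        = undecided ∞ (Bounded-max (Within⇒Bounded w) bf)
    Verdict-⊔ (undecided {s} _ (fin _)) (sat w')                = sat (Within-minʳ s w')
    Verdict-⊔ (undecided {s} _ ∞)       (sat w')                = sat (Within-minʳ s w')
    Verdict-⊔ (undecided bs@(fin _) bf) (unsat w'@(fin _))      = undecided bs (Bounded-max bf (Within⇒Bounded w'))
    Verdict-⊔ (undecided ∞ bf)          (unsat w'@(fin _))      = undecided ∞ (Bounded-max bf (Within⇒Bounded w'))
    Verdict-⊔ (undecided bs bf)         (undecided bs' bf')     = undecided (Bounded-min bs bs') (Bounded-max bf bf')

    Verdict-⊓ : ∀ {c c' v v'} → Verdict j c v → Verdict j c' v' → Verdict j (c ⊓ c') (v ∧₃ v')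
    Verdict-⊓ {v = v} {v'} V V' =
      subst (Verdict j _) (¬₃-∨₃-dual v v') (Verdict-swap (Verdict-⊔ (Verdict-swap V) (Verdict-swap V')))

  Verdict-⊕1 : ∀ {j c v} → Verdict (suc j) c v → Verdict j (c ⊕1) v
  Verdict-⊕1 (sat w)           = sat (Within-⊕1 w)
  Verdict-⊕1 (unsat w)         = unsat (Within-⊕1 w)
  Verdict-⊕1 (undecided bs bf) = undecided (Bounded-⊕1 bs) (Bounded-⊕1 bf)

  Verdict-𝐅-beyond : ∀ {j c v} → len < j → Verdict j c v → Verdict j (c ⊔ (dash , ∞)) v
  Verdict-𝐅-beyond len<j (sat w)   = ⊥-elim (Within-beyond len<j w)
  Verdict-𝐅-beyond len<j (unsat w) = ⊥-elim (Within-beyond len<j w)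
  Verdict-𝐅-beyond _ (undecided {s} bs bf) rewrite min₊-dashʳ s = undecided bs (Bounded-max bf ∞)

  Verdict-𝐔-beyond : ∀ {j c c' v v'} → len < j → Verdict j c v → Verdict j c' v' →
                     Verdict j (c ⊔ (c' ⊓ (dash , ∞))) v
  Verdict-𝐔-beyond len<j (sat w)   _ = ⊥-elim (Within-beyond len<j w)
  Verdict-𝐔-beyond len<j (unsat w) _ = ⊥-elim (Within-beyond len<j w)
  Verdict-𝐔-beyond len<j (undecided _ _) (sat w)   = ⊥-elim (Within-beyond len<j w)
  Verdict-𝐔-beyond len<j (undecided _ _) (unsat w) = ⊥-elim (Within-beyond len<j w)
  Verdict-𝐔-beyond _ (undecided {s} bs bf) (undecided {s'} _ bf')
    rewrite max₊-dashʳ s' | min₊-dashʳ s = undecided bs (Bounded-max bf (Bounded-min bf' ∞))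

nth-just⇒< : ∀ {A : Set} (xs : List A) k {x} → nth xs k ≡ just x → k < length xs
nth-just⇒< (_ ∷ _)  zero    _  = s≤s z≤n
nth-just⇒< (_ ∷ xs) (suc k) eq = s≤s (nth-just⇒< xs k eq)

module _ {n : ℕ} (π : Trace n) where
  open Semantics π
  open Verdicts len

  holds⇒≤len : ∀ p j {b} → holds p j ≡ just b → j ≤ len
  holds⇒≤len p zero    _  = z≤n
  holds⇒≤len p (suc j) eq with nth π j in nth≡
  ... | just _ = nth-just⇒< π j nth≡

  module _ (φ : Formula n) {j : ℕ} where

    μ-𝐅-inside : j ≤ len → μ (𝐅 φ) j ≡ μ φ j ∨₃ μ (𝐗 (𝐅 φ)) j
    μ-𝐅-inside = iter-inside

    μ-𝐅-beyond : len < j → μ (𝐅 φ) j ≡ μ φ j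
    μ-𝐅-beyond = iter-beyond

    d-𝐅-inside : j ≤ len → d (𝐅 φ) j ≡ d φ j ⊔ d (𝐗 (𝐅 φ)) j
    d-𝐅-inside = iter-inside

    d-𝐅-beyond : len < j → d (𝐅 φ) j ≡ d φ j ⊔ (dash , ∞)
    d-𝐅-beyond = iter-beyond

    r-𝐅-inside : j ≤ len → r (𝐅 φ) j ≡ e φ j ∨₅ r (𝐗 (𝐅 φ)) j
    r-𝐅-inside = iter-inside

    r-𝐅-beyond : len < j → r (𝐅 φ) j ≡ e φ j
    r-𝐅-beyond = iter-beyond

  module _ (φ ψ : Formula n) {j : ℕ} where

    μ-𝐔-inside : j ≤ len → μ (φ 𝐔 ψ) j ≡ μ ψ j ∨₃ (μ φ j ∧₃ μ (𝐗 (φ 𝐔 ψ)) j)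
    μ-𝐔-inside = iter-inside

    μ-𝐔-beyond : len < j → μ (φ 𝐔 ψ) j ≡ μ ψ j
    μ-𝐔-beyond = iter-beyond

    d-𝐔-inside : j ≤ len → d (φ 𝐔 ψ) j ≡ d ψ j ⊔ (d φ j ⊓ d (𝐗 (φ 𝐔 ψ)) j)
    d-𝐔-inside = iter-inside

    d-𝐔-beyond : len < j → d (φ 𝐔 ψ) j ≡ d ψ j ⊔ (d φ j ⊓ (dash , ∞))
    d-𝐔-beyond = iter-beyond

    r-𝐔-inside : j ≤ len → r (φ 𝐔 ψ) j ≡ e ψ j ∨₅ (e φ j ∧₅ e (𝐗 (φ 𝐔 ψ)) j)
    r-𝐔-inside = iter-inside

    r-𝐔-beyond : len < j → r (φ 𝐔 ψ) j ≡ e ψ j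
    r-𝐔-beyond = iter-beyond

  μ-verdict : ∀ φ j → Verdict j (d φ j) (μ φ j)
  μ-verdict (atom p) j with holds p j in holds≡
  ... | just true  = sat (fin (holds⇒≤len p j holds≡))
  ... | just false = unsat (fin (holds⇒≤len p j holds≡))
  ... | nothing    = undecided (fin 0) (fin 0)
  μ-verdict (¬ᶠ φ)   j = Verdict-swap (μ-verdict φ j)
  μ-verdict (φ ∨ᶠ ψ) j = Verdict-⊔ (μ-verdict φ j) (μ-verdict ψ j)
  μ-verdict (𝐗 φ)    j = Verdict-⊕1 (μ-verdict φ (suc j))
  μ-verdict (𝐅 φ) = backward-ind len (λ j → Verdict j (d (𝐅 φ) j) (μ (𝐅 φ) j)) beyond inside
    where
    beyond : ∀ j → len < j → Verdict j (d (𝐅 φ) j) (μ (𝐅 φ) j)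
    beyond j len<j rewrite d-𝐅-beyond φ len<j | μ-𝐅-beyond φ len<j =
      Verdict-𝐅-beyond len<j (μ-verdict φ j)
    inside : ∀ j → j ≤ len → Verdict (suc j) (d (𝐅 φ) (suc j)) (μ (𝐅 φ) (suc j)) →
             Verdict j (d (𝐅 φ) j) (μ (𝐅 φ) j)
    inside j j≤len V rewrite d-𝐅-inside φ j≤len | μ-𝐅-inside φ j≤len =
      Verdict-⊔ (μ-verdict φ j) (Verdict-⊕1 V)
  μ-verdict (φ 𝐔 ψ) = backward-ind len (λ j → Verdict j (d (φ 𝐔 ψ) j) (μ (φ 𝐔 ψ) j)) beyond inside
    where
    beyond : ∀ j → len < j → Verdict j (d (φ 𝐔 ψ) j) (μ (φ 𝐔 ψ) j)
    beyond j len<j rewrite d-𝐔-beyond φ ψ len<j | μ-𝐔-beyond φ ψ len<j =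
      Verdict-𝐔-beyond len<j (μ-verdict ψ j) (μ-verdict φ j)
    inside : ∀ j → j ≤ len → Verdict (suc j) (d (φ 𝐔 ψ) (suc j)) (μ (φ 𝐔 ψ) (suc j)) →
             Verdict j (d (φ 𝐔 ψ) j) (μ (φ 𝐔 ψ) j)
    inside j j≤len V rewrite d-𝐔-inside φ ψ j≤len | μ-𝐔-inside φ ψ j≤len =
      Verdict-⊔ (μ-verdict ψ j) (Verdict-⊓ (μ-verdict φ j) (Verdict-⊕1 V))

  collapse-eAt : ∀ φ j {v rv} → Verdict j (d φ j) v → (v ≡ ?₃ → collapse rv ≡ ?₃) →
                 collapse (eAt φ j rv) ≡ v
  collapse-eAt φ j V rv? with d φ j | V
  ... | _ | sat (fin a+j≤len)   rewrite Equivalence.to T-≡ (≤⇒≤ᵇ a+j≤len) = refl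
  ... | _ | unsat (fin a+j≤len) rewrite Equivalence.to T-≡ (≤⇒≤ᵇ a+j≤len) = refl
  ... | _ | undecided (fin b₁) (fin b₂) =
    collapse-if ((len <ᵇ b₁ + j) ∧ (len <ᵇ b₂ + j)) (collapse-ranked (rv? refl) (pred φ j) (pred (¬ᶠ φ) j)) refl
  ... | _ | undecided (fin b₁) ∞ =
    collapse-if (len <ᵇ b₁ + j) (collapse-ranked (rv? refl) (pred φ j) ?₃) refl
  ... | _ | undecided ∞ (fin b₂) =
    collapse-if (len <ᵇ b₂ + j) (collapse-ranked (rv? refl) ?₃ (pred (¬ᶠ φ) j)) refl
  ... | _ | undecided ∞ ∞ = rv? refl

  collapse-e-via-r : ∀ φ j → (μ φ j ≡ ?₃ → collapse (r φ j) ≡ ?₃) → collapse (e φ j) ≡ μ φ j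
  collapse-e-via-r φ j = collapse-eAt φ j (μ-verdict φ j)

  mutual
    collapse-e : ∀ φ j → collapse (e φ j) ≡ μ φ j
    collapse-e φ j = collapse-e-via-r φ j (collapse-r φ j)

    collapse-r : ∀ φ j → μ φ j ≡ ?₃ → collapse (r φ j) ≡ ?₃
    collapse-r (atom p) j _ = refl
    collapse-r (¬ᶠ φ)   j = trans (trans (collapse-¬ (e φ j)) (cong ¬₃ (collapse-e φ j)))
    collapse-r (φ ∨ᶠ ψ) j = trans (trans (collapse-∨ (e φ j) (e ψ j)) (cong₂ _∨₃_ (collapse-e φ j) (collapse-e ψ j)))
    collapse-r (𝐗 φ)    j = trans (collapse-rX φ (suc j))
    collapse-r (𝐅 φ)    j = trans (collapse-r-𝐅 φ j)
    collapse-r (φ 𝐔 ψ)  j = trans (collapse-r-𝐔 φ ψ j)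

    collapse-rX : ∀ φ j → collapse (rX φ j) ≡ μ φ j
    collapse-rX (𝐗 φ)    j = collapse-rX φ (suc j)
    collapse-rX (atom p) j = collapse-e (atom p) j
    collapse-rX (¬ᶠ φ)   j = collapse-e (¬ᶠ φ) j
    collapse-rX (φ ∨ᶠ ψ) j = collapse-e (φ ∨ᶠ ψ) j
    collapse-rX (φ 𝐔 ψ)  j = collapse-e (φ 𝐔 ψ) j
    collapse-rX (𝐅 φ)    j = collapse-e (𝐅 φ) j

    collapse-r-𝐅 : ∀ φ j → collapse (r (𝐅 φ) j) ≡ μ (𝐅 φ) j
    collapse-r-𝐅 φ = backward-ind len (λ j → collapse (r (𝐅 φ) j) ≡ μ (𝐅 φ) j) beyond inside
      where
      open ≡-Reasoning
      beyond : ∀ j → len < j → collapse (r (𝐅 φ) j) ≡ μ (𝐅 φ) j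
      beyond j len<j = begin
        collapse (r (𝐅 φ) j)  ≡⟨ cong collapse (r-𝐅-beyond φ len<j) ⟩
        collapse (e φ j)      ≡⟨ collapse-e φ j ⟩
        μ φ j                 ≡⟨ μ-𝐅-beyond φ len<j ⟨
        μ (𝐅 φ) j             ∎
      inside : ∀ j → j ≤ len → collapse (r (𝐅 φ) (suc j)) ≡ μ (𝐅 φ) (suc j) →
               collapse (r (𝐅 φ) j) ≡ μ (𝐅 φ) j
      inside j j≤len collapse-r-next = begin
        collapse (r (𝐅 φ) j)                              ≡⟨ cong collapse (r-𝐅-inside φ j≤len) ⟩
        collapse (e φ j ∨₅ r (𝐗 (𝐅 φ)) j)                 ≡⟨ collapse-∨ (e φ j) (r (𝐗 (𝐅 φ)) j) ⟩
        collapse (e φ j) ∨₃ collapse (r (𝐗 (𝐅 φ)) j)      ≡⟨ cong₂ _∨₃_ (collapse-e φ j) (collapse-e-via-r (𝐅 φ) (suc j) (trans collapse-r-next)) ⟩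
        μ φ j ∨₃ μ (𝐗 (𝐅 φ)) j                            ≡⟨ μ-𝐅-inside φ j≤len ⟨
        μ (𝐅 φ) j                                         ∎

    collapse-r-𝐔 : ∀ φ ψ j → collapse (r (φ 𝐔 ψ) j) ≡ μ (φ 𝐔 ψ) j
    collapse-r-𝐔 φ ψ = backward-ind len (λ j → collapse (r (φ 𝐔 ψ) j) ≡ μ (φ 𝐔 ψ) j) beyond inside
      where
      open ≡-Reasoning
      beyond : ∀ j → len < j → collapse (r (φ 𝐔 ψ) j) ≡ μ (φ 𝐔 ψ) j
      beyond j len<j = begin
        collapse (r (φ 𝐔 ψ) j)  ≡⟨ cong collapse (r-𝐔-beyond φ ψ len<j) ⟩
        collapse (e ψ j)        ≡⟨ collapse-e ψ j ⟩
        μ ψ j                   ≡⟨ μ-𝐔-beyond φ ψ len<j ⟨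
        μ (φ 𝐔 ψ) j             ∎
      inside : ∀ j → j ≤ len → collapse (r (φ 𝐔 ψ) (suc j)) ≡ μ (φ 𝐔 ψ) (suc j) →
               collapse (r (φ 𝐔 ψ) j) ≡ μ (φ 𝐔 ψ) j
      inside j j≤len collapse-r-next = begin
        collapse (r (φ 𝐔 ψ) j)                                        ≡⟨ cong collapse (r-𝐔-inside φ ψ j≤len) ⟩
        collapse (e ψ j ∨₅ (e φ j ∧₅ e χ j))                          ≡⟨ collapse-∨ (e ψ j) (e φ j ∧₅ e χ j) ⟩
        collapse (e ψ j) ∨₃ collapse (e φ j ∧₅ e χ j)                 ≡⟨ cong (collapse (e ψ j) ∨₃_) (collapse-∧ (e φ j) (e χ j)) ⟩
        collapse (e ψ j) ∨₃ (collapse (e φ j) ∧₃ collapse (e χ j))    ≡⟨ cong₂ _∨₃_ (collapse-e ψ j) (cong₂ _∧₃_ (collapse-e φ j) e-next) ⟩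
        μ ψ j ∨₃ (μ φ j ∧₃ μ χ j)                                     ≡⟨ μ-𝐔-inside φ ψ j≤len ⟨
        μ (φ 𝐔 ψ) j                                                   ∎
        where
        χ : Formula n
        χ = 𝐗 (φ 𝐔 ψ)
        e-next : collapse (e χ j) ≡ μ χ j
        e-next = collapse-e-via-r χ j (trans (collapse-e-via-r (φ 𝐔 ψ) (suc j) (trans collapse-r-next)))

theorem1 : ∀ {n : ℕ} (π : Trace n) (φ : Formula n) (i : ℕ) → i > 0 →
    ((Semantics.μ π φ i ≡ ⊤₃) ⇔ (Semantics.e π φ i ≡ ⊤₅))
    × ((Semantics.μ π φ i ≡ ⊥₃) ⇔ (Semantics.e π φ i ≡ ⊥₅))
    × ((Semantics.μ π φ i ≡ ?₃) ⇔
        ((Semantics.e π φ i ≡ ⊤P) ⊎ (Semantics.e π φ i ≡ ⊥P) ⊎ (Semantics.e π φ i ≡ ?₅)))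
theorem1 π φ i _ = collapse-agrees (Semantics.e π φ i) (collapse-e π φ i)
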